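{- Let $\mathcal{T}$ be an extensional typed combinatory algebra. Then the category $\mathbf{Asm}_{\mathcal{T}}$ satisfies the axiom of choice for all basic assemblies: for all basic assemblies $X,Y$, every assembly $Z$ and every formula $\phi(x,y,z)$ of the internal logic, \[ (\forall x^X \exists y^Y \, \phi(x,y,z)) \rightarrow (\exists f^{X \to Y} \forall x^X \, \phi(x,fx,z)) \] is valid in $\mathbf{Asm}_{\mathcal T}$. In particular, if $\mathcal{T}$ is also standard, the axiom of choice holds in $\mathbf{Asm}_{\mathcal T}$ for all finite types (the objects generated from the terminal object and the natural numbers object by finite products and exponentials).
   Context: A typed combinatory algebra (tca) $\mathcal{T}$ consists of a set of types containing distinguished types $\bot,\top,N$ and closed under binary operations $\times,\to,+$; for each type $T$ a set $|T|$; and total application maps $|S\to T|\times|S|\to|T|$, $(a,b)\mapsto ab$, such that for all types $S,T,U$ there are elements $\mathsf{exf}\in|\bot\to S|$, $\mathsf{t}\in|\top|$, $\mathsf{k}$, $\mathsf{s}$, $\mathsf{pair}\in|S\to T\to S\times T|$, $\mathsf{fst}$, $\mathsf{snd}$, $\mathsf{inl}$, $\mathsf{inr}$, $\mathsf{case}$, $\mathsf{0}\in|N|$, $\mathsf{succ}\in|N\to N|$, $\mathsf{R}\in|S\to(N\to(S\to S))\to(N\to S)|$ with $\mathsf{k}ab=a$, $\mathsf{s}abc=ac(bc)$, $\mathsf{fst}(\mathsf{pair}ab)=a$, $\mathsf{snd}(\mathsf{pair}ab)=b$, $\mathsf{case}ab(\mathsf{inl}x)=ax$, $\mathsf{case}ab(\mathsf{inr}x)=bx$,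 $\mathsf{R}ab\mathsf{0}=a$, $\mathsf{R}ab(\mathsf{succ}n)=bn(\mathsf{R}abn)$. $\mathcal{T}$ is extensional if the maps $|S\times T|\to|S|\times|T|$, $x\mapsto(\mathsf{fst}x,\mathsf{snd}x)$ and $|T\to S|\to|S|^{|T|}$, $x\mapsto(y\mapsto xy)$ are injective and $|\top|=\{\mathsf t\}$; standard if $n\mapsto\mathsf{succ}^n\mathsf 0$ is a bijection $\mathbb N\to|N|$. An assembly over $\mathcal{T}$ is a triple $(X,A,\alpha)$ with $X$ a set, $A$ a type, and $\alpha(x)\subseteq|A|$ inhabited for $x\in X$; morphisms $(X,A,\alpha)\to(Y,B,\beta)$ are functions $f:X\to Y$ such that some $e\in|A\to B|$ satisfies $a\in\alpha(x)\Rightarrow ea\in\beta(f(x))$. $\mathbf{Asm}_{\mathcal{T}}$ is a cartesian closed Heyting category with natural numbers object $(\mathbb N,N,n\mapsto\{\mathsf{succ}^n\mathsf 0\})$; its internal logic is meant. An assembly is strongly modest if $a\in\alpha(x)$ and $a\in\alpha(y)$ imply $x=y$, and each $\alpha(x)$ is a singleton; exhaustive if every $a\in|A|$ lies in some $\alpha(x)$; basic if it is strongly modest and exhaustive. -}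

module Defs where

open import Level using (0ℓ)
open import Data.Nat using (ℕ; zero; suc)
open import Data.Product using (Σ; _×_; _,_; proj₁; proj₂)
open import Data.Unit using (⊤; tt)
open import Relation.Binary.PropositionalEquality using (_≡_; subst; sym)
open import Function.Definitions using (Injective; Surjective)


record TCA : Set₁ where
  infixr 5 _⇒_
  infixr 6 _⊕_
  infixr 7 _⊗_
  infixl 9 _·_
  field
    Ty  : Set
    𝟘 𝟙 Nat : Ty
    _⊗_ _⇒_ _⊕_ : Ty → Ty → Ty
    El  : Ty → Set
    _·_ : ∀ {S T} → El (S ⇒ T) → El S → El T

    exf  : ∀ {S} → El (𝟘 ⇒ S)
    t    : El 𝟙
    k    : ∀ {S T} → El (S ⇒ T ⇒ S)
    s    : ∀ {S T U} → El ((S ⇒ T ⇒ U) ⇒ (S ⇒ T) ⇒ S ⇒ U)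
    pair : ∀ {S T} → El (S ⇒ T ⇒ S ⊗ T)
    fst  : ∀ {S T} → El (S ⊗ T ⇒ S)
    snd  : ∀ {S T} → El (S ⊗ T ⇒ T)
    inl  : ∀ {S T} → El (S ⇒ S ⊕ T)
    inr  : ∀ {S T} → El (T ⇒ S ⊕ T)
    case : ∀ {S T U} → El ((S ⇒ U) ⇒ (T ⇒ U) ⇒ S ⊕ T ⇒ U)
    zer  : El Nat
    succ : El (Nat ⇒ Nat)
    R    : ∀ {S} → El (S ⇒ (Nat ⇒ S ⇒ S) ⇒ Nat ⇒ S)

    k-eq    : ∀ {S T} (a : El S) (b : El T) → k · a · b ≡ a
    s-eq    : ∀ {S T U} (a : El (S ⇒ T ⇒ U)) (b : El (S ⇒ T)) (c : El S) →
              s · a · b · c ≡ a · c · (b · c)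
    fst-eq  : ∀ {S T} (a : El S) (b : El T) → fst · (pair · a · b) ≡ a
    snd-eq  : ∀ {S T} (a : El S) (b : El T) → snd · (pair · a · b) ≡ b
    inl-eq  : ∀ {S T U} (a : El (S ⇒ U)) (b : El (T ⇒ U)) (x : El S) →
              case · a · b · (inl · x) ≡ a · x
    inr-eq  : ∀ {S T U} (a : El (S ⇒ U)) (b : El (T ⇒ U)) (x : El T) →
              case · a · b · (inr · x) ≡ b · x
    R-zero  : ∀ {S} (a : El S) (b : El (Nat ⇒ S ⇒ S)) → R · a · b · zer ≡ a
    R-succ  : ∀ {S} (a : El S) (b : El (Nat ⇒ S ⇒ S)) (n : El Nat) →
              R · a · b · (succ · n) ≡ b · n · (R · a · b · n)

  numeral : ℕ → El Nat
  numeral zero    = zer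
  numeral (suc n) = succ · numeral n

record Extensional (𝒯 : TCA) : Set where
  open TCA 𝒯
  field
    pair-inj : ∀ {S T} (x y : El (S ⊗ T)) → fst · x ≡ fst · y → snd · x ≡ snd · y → x ≡ y
    fun-inj  : ∀ {S T} (x y : El (T ⇒ S)) → (∀ b → x · b ≡ y · b) → x ≡ y
    top-t    : ∀ (u : El 𝟙) → u ≡ t

Standard : TCA → Set
Standard 𝒯 = Injective _≡_ _≡_ numeral × Surjective _≡_ _≡_ numeral
  where open TCA 𝒯

module Assemblies (𝒯 : TCA) where
  open TCA 𝒯

  record Asm : Set₁ where
    field
      Car : Set
      ty  : Ty
      rz  : Car → El ty → Set            -- a ∈ α(x)  as  rz x a
      inh : ∀ x → Σ (El ty) (rz x)
  open Asm public

  Tracks : (X Y : Asm) → El (ty X ⇒ ty Y) → (Car X → Car Y) → Set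
  Tracks X Y e f = ∀ x a → rz X x a → rz Y (f x) (e · a)

  record Hom (X Y : Asm) : Set where
    constructor hom
    field
      fun      : Car X → Car Y
      tracker  : El (ty X ⇒ ty Y)
      tracks   : Tracks X Y tracker fun
  open Hom public

  StronglyModest : Asm → Set
  StronglyModest X =
    (∀ x y a → rz X x a → rz X y a → x ≡ y) ×
    (∀ x a b → rz X x a → rz X x b → a ≡ b)

  Exhaustive : Asm → Set
  Exhaustive X = ∀ a → Σ (Car X) (λ x → rz X x a)

  Basic : Asm → Set
  Basic X = StronglyModest X × Exhaustive X

  𝟏 : Asm
  𝟏 = record { Car = ⊤ ; ty = 𝟙 ; rz = λ _ a → a ≡ t ; inh = λ _ → t , _≡_.refl }

  NNO : Asm
  NNO = record { Car = ℕ ; ty = Nat ; rz = λ n a → a ≡ numeral n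
               ; inh = λ n → numeral n , _≡_.refl }

  _×ₐ_ : Asm → Asm → Asm
  X ×ₐ Y = record
    { Car = Car X × Car Y
    ; ty  = ty X ⊗ ty Y
    ; rz  = λ { (x , y) c → rz X x (fst · c) × rz Y y (snd · c) }
    ; inh = λ { (x , y) → inhPair x y } }
    where
    inhPair : ∀ x y → Σ (El (ty X ⊗ ty Y)) λ c → rz X x (fst · c) × rz Y y (snd · c)
    inhPair x y with inh X x | inh Y y
    ... | a , ra | b , rb =
      pair · a · b , subst (rz X x) (sym (fst-eq a b)) ra , subst (rz Y y) (sym (snd-eq a b)) rb

  Exp : Asm → Asm → Asm
  Exp X Y = record
    { Car = Hom X Y
    ; ty  = ty X ⇒ ty Y
    ; rz  = λ h e → Tracks X Y e (fun h)
    ; inh = λ h → tracker h , tracks h }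

  -- A predicate (subobject) on an object with underlying set I is given by a
  -- realizer type and a realizability relation  holds i e  ("e realizes P(i)").

  record Pred (I : Set) : Set₁ where
    field
      pty   : Ty
      holds : I → El pty → Set
  open Pred public

  reindex : ∀ {I J : Set} → (J → I) → Pred I → Pred J
  reindex g P = record { pty = pty P ; holds = λ j e → holds P (g j) e }

  _⇒ₚ_ : ∀ {I} → Pred I → Pred I → Pred I
  P ⇒ₚ Q = record
    { pty   = pty P ⇒ pty Q
    ; holds = λ i e → ∀ b → holds P i b → holds Q i (e · b) }

  ∀ₚ : ∀ {I} (X : Asm) → Pred (Car X × I) → Pred I
  ∀ₚ X P = record
    { pty   = ty X ⇒ pty P
    ; holds = λ i e → ∀ x a → rz X x a → holds P (x , i) (e · a) }

  ∃ₚ : ∀ {I} (X : Asm) → Pred (Car X × I) → Pred I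
  ∃ₚ X P = record
    { pty   = ty X ⊗ pty P
    ; holds = λ i e → Σ (Car X) λ x → rz X x (fst · e) × holds P (x , i) (snd · e) }

  Valid : (Z : Asm) → Pred (Car Z) → Set
  Valid Z P = Σ (El (ty Z ⇒ pty P)) λ r → ∀ z c → rz Z z c → holds P z (r · c)

  ACFormula : (X Y Z : Asm) → Pred (Car X × Car Y × Car Z) → Pred (Car Z)
  ACFormula X Y Z φ =
    ∀ₚ X (∃ₚ Y (reindex (λ { (y , x , z) → x , y , z }) φ))
    ⇒ₚ
    ∃ₚ (Exp X Y) (∀ₚ X (reindex (λ { (x , f , z) → x , fun f x , z }) φ))

  AC : (X Y : Asm) → Set₁
  AC X Y = (Z : Asm) (φ : Pred (Car X × Car Y × Car Z)) → Valid Z (ACFormula X Y Z φ)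

  data FinType : Set where
    unit nat : FinType
    _×ᶠ_ _→ᶠ_ : FinType → FinType → FinType

  ⟦_⟧ : FinType → Asm
  ⟦ unit ⟧    = 𝟏
  ⟦ nat ⟧     = NNO
  ⟦ σ ×ᶠ τ ⟧  = ⟦ σ ⟧ ×ₐ ⟦ τ ⟧
  ⟦ σ →ᶠ τ ⟧  = Exp ⟦ σ ⟧ ⟦ τ ⟧

{-# OPTIONS --safe #-}
-- If every point x of X has a single realizer aₓ, a realizer e of ∀x∃y φ yields the
-- choice function f x := the witness that e picks at aₓ; it is tracked by fst ∘ e,
-- and snd ∘ e realizes φ(x, f x, z), independently of the parameter z.
-- Finite types are basic by induction: extensionality of 𝒯 makes a realizer of a
-- product or of a function determined by its components or by its values on the
-- exhaustive domain, and a point of an exponential is determined by its function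
-- and tracker; the latter needs function extensionality and proof-irrelevant
-- realizability, which is therefore carried along the induction.
module Submission where

open import Defs
open import Level using (0ℓ)
open import Data.Product using (Σ; _×_; _,_; proj₁; proj₂)
open import Data.Unit using (tt)
open import Axiom.Extensionality.Propositional using (Extensionality)
open import Relation.Nullary.Irrelevant using (Irrelevant)
open import Relation.Binary.PropositionalEquality
  using (_≡_; refl; sym; trans; cong; cong₂; subst; module ≡-Reasoning)

module Combinators (𝒯 : TCA) where
  open TCA 𝒯
  open ≡-Reasoning

  postcompose : ∀ {A B C} → El (B ⇒ C) → El ((A ⇒ B) ⇒ A ⇒ C)
  postcompose f = s · (k · f)

  postcompose-eq : ∀ {A B C} (f : El (B ⇒ C)) (g : El (A ⇒ B)) (a : El A) →
                   postcompose f · g · a ≡ f · (g · a)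
  postcompose-eq f g a = begin
    s · (k · f) · g · a       ≡⟨ s-eq (k · f) g a ⟩
    k · f · a · (g · a)       ≡⟨ cong (_· (g · a)) (k-eq f a) ⟩
    f · (g · a)               ∎

  unzip : ∀ {A B C} → El ((A ⇒ B ⊗ C) ⇒ (A ⇒ B) ⊗ (A ⇒ C))
  unzip = s · (s · (k · pair) · postcompose fst) · postcompose snd

  unzip-eq : ∀ {A B C} (e : El (A ⇒ B ⊗ C)) →
             unzip · e ≡ pair · (postcompose fst · e) · (postcompose snd · e)
  unzip-eq e = begin
    s · (s · (k · pair) · postcompose fst) · postcompose snd · e
      ≡⟨ s-eq _ _ e ⟩
    s · (k · pair) · postcompose fst · e · (postcompose snd · e)
      ≡⟨ cong (_· (postcompose snd · e)) (s-eq _ _ e) ⟩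
    k · pair · e · (postcompose fst · e) · (postcompose snd · e)
      ≡⟨ cong (λ u → u · (postcompose fst · e) · (postcompose snd · e)) (k-eq pair e) ⟩
    pair · (postcompose fst · e) · (postcompose snd · e)
      ∎

  fst-unzip : ∀ {A B C} (e : El (A ⇒ B ⊗ C)) (a : El A) →
              fst · (unzip · e) · a ≡ fst · (e · a)
  fst-unzip e a = begin
    fst · (unzip · e) · a                                          ≡⟨ cong (λ u → fst · u · a) (unzip-eq e) ⟩
    fst · (pair · (postcompose fst · e) · (postcompose snd · e)) · a ≡⟨ cong (_· a) (fst-eq _ _) ⟩
    postcompose fst · e · a                                        ≡⟨ postcompose-eq fst e a ⟩
    fst · (e · a)                                                  ∎

  snd-unzip : ∀ {A B C} (e : El (A ⇒ B ⊗ C)) (a : El A) →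
              snd · (unzip · e) · a ≡ snd · (e · a)
  snd-unzip e a = begin
    snd · (unzip · e) · a                                          ≡⟨ cong (λ u → snd · u · a) (unzip-eq e) ⟩
    snd · (pair · (postcompose fst · e) · (postcompose snd · e)) · a ≡⟨ cong (_· a) (snd-eq _ _) ⟩
    postcompose snd · e · a                                        ≡⟨ postcompose-eq snd e a ⟩
    snd · (e · a)                                                  ∎

module Choice (𝒯 : TCA) where
  open TCA 𝒯
  open Assemblies 𝒯
  open Combinators 𝒯

  UniqueRealizers : Asm → Set
  UniqueRealizers X = ∀ x a b → rz X x a → rz X x b → a ≡ b

  ac-uniqueRealizers : (X Y : Asm) → UniqueRealizers X → AC X Y
  ac-uniqueRealizers X Y unique Z φ = k · unzip , λ z c _ → realizes z c
    where
    realizes : ∀ z (c : El (ty Z)) → holds (ACFormula X Y Z φ) z (k · unzip · c)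
    realizes z c e total rewrite k-eq (unzip {ty X} {ty Y} {pty φ}) c =
      hom choice (fst · (unzip · e)) choice-tracked , choice-tracked , choice-satisfies
      where
      chosen : ∀ x → Σ (Car Y) λ y →
               rz Y y (fst · (e · proj₁ (inh X x))) × holds φ (x , y , z) (snd · (e · proj₁ (inh X x)))
      chosen x = total x (proj₁ (inh X x)) (proj₂ (inh X x))

      choice : Car X → Car Y
      choice x = proj₁ (chosen x)

      choice-spec : ∀ x a → rz X x a →
                    rz Y (choice x) (fst · (e · a)) × holds φ (x , choice x , z) (snd · (e · a))
      choice-spec x a ra with unique x a (proj₁ (inh X x)) ra (proj₂ (inh X x))
      ... | refl = proj₂ (chosen x)

      choice-tracked : Tracks X Y (fst · (unzip · e)) choice
      choice-tracked x a ra =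
        subst (rz Y (choice x)) (sym (fst-unzip e a)) (proj₁ (choice-spec x a ra))

      choice-satisfies : ∀ x a → rz X x a → holds φ (x , choice x , z) (snd · (unzip · e) · a)
      choice-satisfies x a ra =
        subst (holds φ (x , choice x , z)) (sym (snd-unzip e a)) (proj₂ (choice-spec x a ra))

module FiniteTypes (𝒯 : TCA) where
  open TCA 𝒯
  open Assemblies 𝒯
  open Choice 𝒯

  Modest : Asm → Set
  Modest X = ∀ x y a → rz X x a → rz X y a → x ≡ y

  RealizersIrrelevant : Asm → Set
  RealizersIrrelevant X = ∀ x a → Irrelevant (rz X x a)

  ×-modest : ∀ {X Y} → Modest X → Modest Y → Modest (X ×ₐ Y)
  ×-modest modX modY (x , y) (x' , y') c (p , q) (p' , q') =
    cong₂ _,_ (modX x x' _ p p') (modY y y' _ q q')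

  ×-exhaustive : ∀ {X Y} → Exhaustive X → Exhaustive Y → Exhaustive (X ×ₐ Y)
  ×-exhaustive exhX exhY c =
    (proj₁ (exhX (fst · c)) , proj₁ (exhY (snd · c))) , proj₂ (exhX (fst · c)) , proj₂ (exhY (snd · c))

  ×-irrelevant : ∀ {X Y} → RealizersIrrelevant X → RealizersIrrelevant Y → RealizersIrrelevant (X ×ₐ Y)
  ×-irrelevant irrX irrY (x , y) c (p , q) (p' , q') = cong₂ _,_ (irrX x _ p p') (irrY y _ q q')

  Exp-exhaustive : ∀ {X Y} → UniqueRealizers X → Exhaustive Y → Exhaustive (Exp X Y)
  Exp-exhaustive {X} {Y} unique exhY e = hom f e f-tracked , f-tracked
    where
    f : Car X → Car Y
    f x = proj₁ (exhY (e · proj₁ (inh X x)))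

    f-tracked : Tracks X Y e f
    f-tracked x a ra with unique x a (proj₁ (inh X x)) ra (proj₂ (inh X x))
    ... | refl = proj₂ (exhY (e · a))

  NNO-basic : Standard 𝒯 → Basic NNO
  NNO-basic (injective , surjective) =
    ((λ _ _ _ p q → injective (trans (sym p) q)) , (λ _ _ _ p q → trans p (sym q)))
    , λ a → proj₁ (surjective a) , sym (proj₂ (surjective a) refl)

  module _ (E : Extensional 𝒯) where
    open Extensional E

    𝟏-basic : Basic 𝟏
    𝟏-basic = ((λ _ _ _ _ _ → refl) , (λ _ _ _ p q → trans p (sym q))) , λ a → tt , top-t a

    ×-uniqueRealizers : ∀ {X Y} → UniqueRealizers X → UniqueRealizers Y → UniqueRealizers (X ×ₐ Y)
    ×-uniqueRealizers uniqX uniqY (x , y) c c' (p , q) (p' , q') =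
      pair-inj c c' (uniqX x _ _ p p') (uniqY y _ _ q q')

    Exp-uniqueRealizers : ∀ {X Y} → Exhaustive X → UniqueRealizers Y → UniqueRealizers (Exp X Y)
    Exp-uniqueRealizers exhX uniqY h e e' p q = fun-inj e e' λ a →
      let (x , ra) = exhX a in uniqY (fun h x) _ _ (p x a ra) (q x a ra)

    module _ (fe : Extensionality 0ℓ 0ℓ) where

      Hom-≡ : ∀ {X Y} → RealizersIrrelevant Y → {h h' : Hom X Y} →
              fun h ≡ fun h' → tracker h ≡ tracker h' → h ≡ h'
      Hom-≡ irrY {hom f e p} {hom _ _ p'} refl refl =
        cong (hom f e) (fe λ x → fe λ a → fe λ ra → irrY _ _ (p x a ra) (p' x a ra))

      Exp-irrelevant : ∀ {X Y} → RealizersIrrelevant Y → RealizersIrrelevant (Exp X Y)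
      Exp-irrelevant irrY h e p q = fe λ x → fe λ a → fe λ ra → irrY _ _ (p x a ra) (q x a ra)

      Exp-modest : ∀ {X Y} → Exhaustive X → Modest Y → UniqueRealizers Y → RealizersIrrelevant Y →
                   Modest (Exp X Y)
      Exp-modest {X} exhX modY uniqY irrY h h' e p p' = Hom-≡ irrY same-fun same-tracker
        where
        same-fun : fun h ≡ fun h'
        same-fun = fe λ x → let (a , ra) = inh X x in modY _ _ _ (p x a ra) (p' x a ra)

        same-tracker : tracker h ≡ tracker h'
        same-tracker = trans (Exp-uniqueRealizers exhX uniqY h _ _ (tracks h) p)
                             (sym (Exp-uniqueRealizers exhX uniqY h' _ _ (tracks h') p'))

      ×-basic : ∀ {X Y} → Basic X × RealizersIrrelevant X → Basic Y × RealizersIrrelevant Y →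
                Basic (X ×ₐ Y) × RealizersIrrelevant (X ×ₐ Y)
      ×-basic {X} {Y} (((modX , uniqX) , exhX) , irrX) (((modY , uniqY) , exhY) , irrY) =
        ((×-modest {X} {Y} modX modY , ×-uniqueRealizers {X} {Y} uniqX uniqY)
        , ×-exhaustive {X} {Y} exhX exhY)
        , ×-irrelevant {X} {Y} irrX irrY

      Exp-basic : ∀ {X Y} → Basic X × RealizersIrrelevant X → Basic Y × RealizersIrrelevant Y →
                  Basic (Exp X Y) × RealizersIrrelevant (Exp X Y)
      Exp-basic {X} {Y} (((_ , uniqX) , exhX) , _) (((modY , uniqY) , exhY) , irrY) =
        ((Exp-modest {X} {Y} exhX modY uniqY irrY , Exp-uniqueRealizers {X} {Y} exhX uniqY)
        , Exp-exhaustive {X} {Y} uniqX exhY)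
        , Exp-irrelevant {X} {Y} irrY

      finType-basic : Standard 𝒯 → ∀ σ → Basic ⟦ σ ⟧ × RealizersIrrelevant ⟦ σ ⟧
      finType-basic _ unit = 𝟏-basic , λ { _ _ refl refl → refl }
      finType-basic standard nat = NNO-basic standard , λ { _ _ refl refl → refl }
      finType-basic standard (σ ×ᶠ τ) =
        ×-basic {⟦ σ ⟧} {⟦ τ ⟧} (finType-basic standard σ) (finType-basic standard τ)
      finType-basic standard (σ →ᶠ τ) =
        Exp-basic {⟦ σ ⟧} {⟦ τ ⟧} (finType-basic standard σ) (finType-basic standard τ)

mainTheorem5 : (𝒯 : TCA) → Extensional 𝒯 →
    let open Assemblies 𝒯 in
    ((X Y : Asm) → Basic X → Basic Y → AC X Y)
    ×
    (Extensionality 0ℓ 0ℓ → Standard 𝒯 → (σ τ : FinType) → AC ⟦ σ ⟧ ⟦ τ ⟧)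
mainTheorem5 𝒯 E =
  (λ X Y ((_ , uniqX) , _) _ → ac-uniqueRealizers X Y uniqX)
  , λ fe standard σ τ →
      let ((_ , uniqσ) , _) , _ = finType-basic E fe standard σ
      in ac-uniqueRealizers ⟦ σ ⟧ ⟦ τ ⟧ uniqσ
  where
  open Choice 𝒯
  open FiniteTypes 𝒯
  open Assemblies 𝒯
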